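{- Let $r\ge 2$ and let $F$ be a $k\times\ell$ $(0,1)$-matrix. Let $s$ be the number of columns of $\mathrm{supp}(F)$ and let $\mu=\max_{\mathbf x}\mu(\mathbf x,F)$ be the maximum column multiplicity in $F$. Then for all $m$, \[ \mathrm{forb}(m,r,\mathrm{Sym}(F))\le \mathrm{forb}(m,r,\mathrm{Sym}(\mathrm{supp}(F)))+\binom{m}{k}\binom{r}{2}(\mu-1)\,k!\,s. \]
   Context: An $r$-matrix is a matrix with entries in $\{0,1,\dots,r-1\}$; a matrix is simple if it has no repeated columns. $F\prec A$ means some submatrix of $A$ is a row and column permutation of $F$. For a family $\mathcal F$, $\mathrm{forb}(m,r,\mathcal F)$ is the maximum number of columns of a simple $m$-rowed $r$-matrix $A$ with $F\not\prec A$ for all $F\in\mathcal F$. For a $(0,1)$-matrix $F$, $F(i,j)$ replaces each $0$ by $i$ and each $1$ by $j$; $\mathrm{Sym}(F)=\{F(i,j):0\le i<j\le r-1\}$. $\mu(\mathbf x,F)$ is the number of times column $\mathbf x$ occurs in $F$, and $\mathrm{supp}(F)$ is the simple matrix consisting of all distinct columns $\mathbf x$ with $\mu(\mathbf x,F)>0$. -}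

module Defs where

open import Data.Nat using (ℕ; zero; suc; _+_; _*_; _∸_; _≤_; _⊔_)
open import Data.Bool using (Bool; true; false; if_then_else_)
open import Data.Fin using (Fin; _<_)
open import Data.Fin.Properties using (all?)
open import Data.Product using (Σ; ∃; _×_; _,_)
open import Function.Definitions using (Injective)
open import Relation.Binary.PropositionalEquality using (_≡_)
open import Relation.Nullary using (¬_)
open import Relation.Nullary.Decidable using (⌊_⌋)
import Data.Bool.Properties as BoolP

-- A matrix with m rows and n columns over A, stored as its list of columns:
-- column j is the function (row index ↦ entry).
Col : ℕ → Set → Set
Col m A = Fin m → A

Mat : ℕ → ℕ → Set → Set
Mat m n A = Fin n → Col m A

entry : ∀ {m n A} → Mat m n A → Fin m → Fin n → A
entry M i j = M j i

Simple : ∀ {m n A} → Mat m n A → Set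
Simple M = Injective _≡_ _≡_ M

_≺_ : ∀ {k l m n A} → Mat k l A → Mat m n A → Set
_≺_ {k} {l} {m} {n} F M =
  Σ (Fin k → Fin m) λ σ → Σ (Fin l → Fin n) λ τ →
    Injective _≡_ _≡_ σ × Injective _≡_ _≡_ τ ×
    (∀ i j → entry M (σ i) (τ j) ≡ entry F i j)

-- (0,1)-matrices are Bool-matrices, false = 0, true = 1.
-- F(i,j): replace 0 by i and 1 by j.
subst01 : ∀ {k l r} → Mat k l Bool → Fin r → Fin r → Mat k l (Fin r)
subst01 F a b j i = if F j i then b else a

AvoidsSym : ∀ {k l m n r} → Mat k l Bool → Mat m n (Fin r) → Set
AvoidsSym {r = r} F A = ∀ (a b : Fin r) → a < b → ¬ (subst01 F a b ≺ A)

IsForbSym : (m r : ℕ) → ∀ {k l} → Mat k l Bool → ℕ → Set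
IsForbSym m r F N =
  (Σ (Mat m N (Fin r)) λ A → Simple A × AvoidsSym F A) ×
  (∀ n (A : Mat m n (Fin r)) → Simple A → AvoidsSym F A → n ≤ N)

colEq : ∀ {k} → Col k Bool → Col k Bool → Bool
colEq x y = ⌊ all? (λ i → x i BoolP.≟ y i) ⌋

count : ∀ {l} → (Fin l → Bool) → ℕ
count {zero} P = 0
count {suc l} P = (if P Fin.zero then 1 else 0) + count (λ j → P (Fin.suc j))
  where import Data.Fin as Fin

mult : ∀ {k l} → Col k Bool → Mat k l Bool → ℕ
mult x F = count (λ j → colEq x (F j))

maxFin : ∀ {l} → (Fin l → ℕ) → ℕ
maxFin {zero} f = 0
maxFin {suc l} f = f Fin.zero ⊔ maxFin (λ j → f (Fin.suc j))
  where import Data.Fin as Fin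

-- μ = max_x μ(x, F)  (attained at a column of F; 0 if F has no columns)
maxMult : ∀ {k l} → Mat k l Bool → ℕ
maxMult F = maxFin (λ j → mult (F j) F)

IsSupp : ∀ {k l s} → Mat k s Bool → Mat k l Bool → Set
IsSupp {k} {l} {s} S F =
  Simple S × (∀ (j : Fin s) → ∃ λ (j' : Fin l) → F j' ≡ S j)
           × (∀ (j' : Fin l) → ∃ λ (j : Fin s) → S j ≡ F j')

module Submission where

-- Let A be simple, m-rowed, with N₁ columns and no configuration F(a,b).
-- A "configuration" is a triple (σ, (a,b), j): an injective choice σ of k
-- ordered rows, a pair of symbols a < b and a column j of S = supp F; there
-- are m(m-1)⋯(m-k+1) · C(r,2) · s = C(m,k)·k!·C(r,2)·s of them.  Column i of
-- A realises (σ,(a,b),j) when, on the rows σ, it equals column j of S(a,b).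
-- Delete every column that realises a configuration which is realised by at
-- most μ-1 columns ("rare" configurations): at most (#configurations)·(μ-1)
-- columns go (pruning lemma).  The remaining matrix A' is simple, and it
-- avoids Sym(S): a copy of S(a,b) in A' on rows σ shows that each column of
-- S(a,b) is realised by ≥ μ columns of A on rows σ, and a greedy choice of
-- distinct representatives then finds F(a,b) in A.  Hence |A'| ≤ N₂.

open import Defs
open import Data.Nat using (ℕ; _+_; _*_; _∸_; _≤_; _!)
open import Data.Nat.Combinatorics using (_C_)
open import Data.Bool using (Bool)

open import Data.Nat using (zero; suc; z≤n; s≤s; _<_; _≤?_)
open import Data.Nat.Properties
open import Data.Nat.Combinatorics using (nC1≡n; nCk+nC[k+1]≡[n+1]C[k+1]; k>n⇒nCk≡0)
open import Data.Nat.Solver using (module +-*-Solver)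
import Algebra.Properties.CommutativeSemigroup +-commutativeSemigroup as +-CS
open import Data.Bool using (true; false; if_then_else_; _∧_; _∨_; not)
import Data.Bool.Properties as BoolP
open import Data.Fin as Fin using (Fin; punchIn; punchOut; combine; remQuot; splitAt; _↑ˡ_; _↑ʳ_)
import Data.Fin.Properties as FinP
open import Data.Fin.Properties using (all?)
open import Data.Product using (Σ; ∃; _×_; _,_; proj₁; proj₂)
open import Data.Product.Relation.Binary.Pointwise.NonDependent using (Pointwise)
open import Data.Sum using ([_,_]′)
open import Data.Unit using (⊤; tt)
open import Data.Empty using (⊥-elim)
open import Function using (_∘_; id)
open import Function.Definitions using (Injective)
open import Relation.Binary.PropositionalEquality
open import Relation.Nullary using (¬_; Dec; yes; no)
open import Relation.Nullary.Decidable using (⌊_⌋)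

⌊⌋-complete : ∀ {P : Set} (d : Dec P) → P → ⌊ d ⌋ ≡ true
⌊⌋-complete (yes _) _ = refl
⌊⌋-complete (no ¬p) p = ⊥-elim (¬p p)

⌊⌋-sound : ∀ {P : Set} (d : Dec P) → ⌊ d ⌋ ≡ true → P
⌊⌋-sound (yes p) _ = p
⌊⌋-sound (no _) ()

⌊⌋-refute : ∀ {P : Set} (d : Dec P) → ⌊ d ⌋ ≡ false → ¬ P
⌊⌋-refute d e p with () ← trans (sym (⌊⌋-complete d p)) e

⌊⌋-cong : ∀ {P Q : Set} (d : Dec P) (e : Dec Q) → (P → Q) → (Q → P) → ⌊ d ⌋ ≡ ⌊ e ⌋
⌊⌋-cong (yes _) (yes _) _ _ = refl
⌊⌋-cong (no _)  (no _)  _ _ = refl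
⌊⌋-cong (yes p) (no ¬q) f _ = ⊥-elim (¬q (f p))
⌊⌋-cong (no ¬p) (yes q) _ g = ⊥-elim (¬p (g q))

colEq-sound : ∀ {k} {x y : Col k Bool} → colEq x y ≡ true → x ≗ y
colEq-sound {x = x} {y} = ⌊⌋-sound (all? (λ i → x i BoolP.≟ y i))

colEq-complete : ∀ {k} {x y : Col k Bool} → x ≗ y → colEq x y ≡ true
colEq-complete {x = x} {y} = ⌊⌋-complete (all? (λ i → x i BoolP.≟ y i))

indicator : Bool → ℕ
indicator b = if b then 1 else 0

count-cong : ∀ {n} {P Q : Fin n → Bool} → P ≗ Q → count P ≡ count Q
count-cong {zero} e = refl
count-cong {suc n} e = cong₂ _+_ (cong indicator (e Fin.zero)) (count-cong (e ∘ Fin.suc))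

count-none : ∀ n → count {n} (λ _ → false) ≡ 0
count-none zero = refl
count-none (suc n) = count-none n

count-∨ : ∀ {n} (P Q : Fin n → Bool) → count (λ i → P i ∨ Q i) ≤ count P + count Q
count-∨ {zero} P Q = z≤n
count-∨ {suc n} P Q with P Fin.zero | Q Fin.zero | count-∨ (P ∘ Fin.suc) (Q ∘ Fin.suc)
... | true  | q     | ih = s≤s (≤-trans ih (+-monoʳ-≤ (count (P ∘ Fin.suc)) (m≤n+m _ (indicator q))))
... | false | true  | ih = ≤-trans (s≤s ih) (≤-reflexive (sym (+-suc _ _)))
... | false | false | ih = ih

count-complement : ∀ {n} (P : Fin n → Bool) → count P + count (not ∘ P) ≡ n
count-complement {zero} P = refl
count-complement {suc n} P with P Fin.zero | count-complement (P ∘ Fin.suc)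
... | true  | ih = cong suc ih
... | false | ih = trans (+-suc _ _) (cong suc ih)

count-witness : ∀ {n} (P : Fin n → Bool) → 1 ≤ count P → ∃ λ i → P i ≡ true
count-witness {suc n} P h with P Fin.zero in e
... | true  = Fin.zero , e
... | false with count-witness (P ∘ Fin.suc) h
...   | i , p = Fin.suc i , p

count-punchIn : ∀ {n} (P : Fin (suc n) → Bool) i →
  count P ≡ indicator (P i) + count (P ∘ punchIn i)
count-punchIn P Fin.zero = refl
count-punchIn {suc n} P (Fin.suc i) = begin
  indicator (P Fin.zero) + count (P ∘ Fin.suc)
    ≡⟨ cong (indicator (P Fin.zero) +_) (count-punchIn (P ∘ Fin.suc) i) ⟩
  indicator (P Fin.zero) + (indicator (P (Fin.suc i)) + rest)
    ≡⟨ +-CS.x∙yz≈y∙xz (indicator (P Fin.zero)) (indicator (P (Fin.suc i))) rest ⟩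
  indicator (P (Fin.suc i)) + (indicator (P Fin.zero) + rest) ∎
  where
  open ≡-Reasoning
  rest = count (P ∘ Fin.suc ∘ punchIn i)

anyOf : ∀ {L} → (Fin L → Bool) → Bool
anyOf {zero} R = false
anyOf {suc L} R = R Fin.zero ∨ anyOf (R ∘ Fin.suc)

anyOf-false : ∀ {L} (R : Fin L → Bool) → anyOf R ≡ false → ∀ ℓ → R ℓ ≡ false
anyOf-false {suc L} R e ℓ with R Fin.zero in e₀
anyOf-false {suc L} R e Fin.zero    | false = e₀
anyOf-false {suc L} R e (Fin.suc ℓ) | false = anyOf-false (R ∘ Fin.suc) e ℓ

count-anyOf : ∀ {n L} (R : Fin n → Fin L → Bool) c → (∀ ℓ → count (λ i → R i ℓ) ≤ c) →
  count (λ i → anyOf (R i)) ≤ L * c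
count-anyOf {n} {zero} R c h = ≤-reflexive (count-none n)
count-anyOf {n} {suc L} R c h =
  ≤-trans (count-∨ (λ i → R i Fin.zero) (λ i → anyOf (R i ∘ Fin.suc)))
          (+-mono-≤ (h Fin.zero) (count-anyOf (λ i → R i ∘ Fin.suc) c (h ∘ Fin.suc)))

select : ∀ {n} (P : Fin n → Bool) → Fin (count P) → Fin n
select {suc n} P i with P Fin.zero
select {suc n} P Fin.zero    | true  = Fin.zero
select {suc n} P (Fin.suc i) | true  = Fin.suc (select (P ∘ Fin.suc) i)
select {suc n} P i           | false = Fin.suc (select (P ∘ Fin.suc) i)

select-satisfies : ∀ {n} (P : Fin n → Bool) i → P (select P i) ≡ true
select-satisfies {suc n} P i with P Fin.zero in e
select-satisfies {suc n} P Fin.zero    | true  = e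
select-satisfies {suc n} P (Fin.suc i) | true  = select-satisfies (P ∘ Fin.suc) i
select-satisfies {suc n} P i           | false = select-satisfies (P ∘ Fin.suc) i

select-injective : ∀ {n} (P : Fin n → Bool) → Injective _≡_ _≡_ (select P)
select-injective {suc n} P {i} {j} eq with P Fin.zero
select-injective {suc n} P {Fin.zero}  {Fin.zero}  eq | true = refl
select-injective {suc n} P {Fin.suc i} {Fin.suc j} eq | true =
  cong Fin.suc (select-injective (P ∘ Fin.suc) (FinP.suc-injective eq))
select-injective {suc n} P eq | false = select-injective (P ∘ Fin.suc) (FinP.suc-injective eq)

module Pruning {n L : ℕ} (realisedBy : Fin n → Fin L → Bool) (c : ℕ) where

  frequency : Fin L → ℕ
  frequency ℓ = count (λ i → realisedBy i ℓ)

  rare : Fin L → Bool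
  rare ℓ = ⌊ frequency ℓ ≤? c ⌋

  discarded : Fin n → Bool
  discarded i = anyOf (λ ℓ → rare ℓ ∧ realisedBy i ℓ)

  kept : Fin n → Bool
  kept = not ∘ discarded

  discarded-bound : count discarded ≤ L * c
  discarded-bound = count-anyOf (λ i ℓ → rare ℓ ∧ realisedBy i ℓ) c rareBound
    where
    rareBound : ∀ ℓ → count (λ i → rare ℓ ∧ realisedBy i ℓ) ≤ c
    rareBound ℓ with rare ℓ in e
    ... | true  = ⌊⌋-sound (frequency ℓ ≤? c) e
    ... | false = ≤-trans (≤-reflexive (count-none n)) z≤n

  pruning-bound : n ≤ count kept + L * c
  pruning-bound = begin
    n                              ≡⟨ sym (count-complement discarded) ⟩
    count discarded + count kept   ≡⟨ +-comm (count discarded) (count kept) ⟩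
    count kept + count discarded   ≤⟨ +-monoʳ-≤ (count kept) discarded-bound ⟩
    count kept + L * c             ∎
    where open ≤-Reasoning

  kept-frequent : ∀ i ℓ → kept i ≡ true → realisedBy i ℓ ≡ true → c < frequency ℓ
  kept-frequent i ℓ isKept realised with discarded i in e
  ... | false = ≰⇒> (⌊⌋-refute (frequency ℓ ≤? c) notRare)
    where
    notRare : rare ℓ ≡ false
    notRare = trans (sym (BoolP.∧-identityʳ (rare ℓ)))
                (subst (λ b → rare ℓ ∧ b ≡ false) realised
                  (anyOf-false (λ ℓ′ → rare ℓ′ ∧ realisedBy i ℓ′) e ℓ))

maxFin-≥ : ∀ {l} (f : Fin l → ℕ) j → f j ≤ maxFin f
maxFin-≥ f Fin.zero = m≤m⊔n (f Fin.zero) _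
maxFin-≥ f (Fin.suc j) = ≤-trans (maxFin-≥ (f ∘ Fin.suc) j) (m≤n⊔m (f Fin.zero) _)

mult-self : ∀ {k l} (F : Mat k (suc l) Bool) → 1 ≤ mult (F Fin.zero) F
mult-self F rewrite colEq-complete {x = F Fin.zero} (λ _ → refl) = s≤s z≤n

distinctRepresentatives : ∀ {k l n} (F : Mat k l Bool) (Q : Fin n → Col k Bool → Bool) →
  (∀ i {x y} → x ≗ y → Q i x ≡ Q i y) →
  (∀ i {x y} → Q i x ≡ true → Q i y ≡ true → x ≗ y) →
  (∀ j → mult (F j) F ≤ count (λ i → Q i (F j))) →
  Σ (Fin l → Fin n) λ τ → Injective _≡_ _≡_ τ × (∀ j → Q (τ j) (F j) ≡ true)
distinctRepresentatives {l = zero} F Q resp unique enough = (λ ()) , (λ { {()} }) , (λ ())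
distinctRepresentatives {l = suc l} {zero} F Q resp unique enough
  with () ← ≤-trans (mult-self F) (enough Fin.zero)
distinctRepresentatives {k} {suc l} {suc n} F Q resp unique enough
  with count-witness (λ i → Q i (F Fin.zero)) (≤-trans (mult-self F) (enough Fin.zero))
... | i₀ , q₀ = τ , τ-injective , τ-typed
  where
  -- once i₀ has type F₀, "i₀ has type x" just says x = F₀
  typeOf-i₀ : ∀ x → colEq x (F Fin.zero) ≡ Q i₀ x
  typeOf-i₀ x with colEq x (F Fin.zero) in e | Q i₀ x in e′
  ... | true  | true  = refl
  ... | false | false = refl
  ... | true  | false = trans (sym q₀) (trans (sym (resp i₀ (colEq-sound e))) e′)
  ... | false | true  = trans (sym e) (colEq-complete (λ t → sym (unique i₀ q₀ e′ t)))

  enough′ : ∀ j → mult (F (Fin.suc j)) (F ∘ Fin.suc) ≤ count (λ i → Q (punchIn i₀ i) (F (Fin.suc j)))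
  enough′ j = +-cancelˡ-≤ (indicator (Q i₀ x)) _ _ (begin
    indicator (Q i₀ x) + mult x (F ∘ Fin.suc)
      ≡⟨ cong (λ b → indicator b + mult x (F ∘ Fin.suc)) (sym (typeOf-i₀ x)) ⟩
    mult x F                                ≤⟨ enough (Fin.suc j) ⟩
    count (λ i → Q i x)                     ≡⟨ count-punchIn (λ i → Q i x) i₀ ⟩
    indicator (Q i₀ x) + count (λ i → Q (punchIn i₀ i) x) ∎)
    where
    open ≤-Reasoning
    x = F (Fin.suc j)

  rest = distinctRepresentatives (F ∘ Fin.suc) (Q ∘ punchIn i₀)
           (resp ∘ punchIn i₀) (unique ∘ punchIn i₀) enough′
  τ′ = proj₁ rest

  τ : Fin (suc l) → Fin (suc n)
  τ Fin.zero    = i₀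
  τ (Fin.suc j) = punchIn i₀ (τ′ j)

  τ-injective : Injective _≡_ _≡_ τ
  τ-injective {Fin.zero}  {Fin.zero}  _  = refl
  τ-injective {Fin.zero}  {Fin.suc j} eq = ⊥-elim (FinP.punchInᵢ≢i i₀ (τ′ j) (sym eq))
  τ-injective {Fin.suc i} {Fin.zero}  eq = ⊥-elim (FinP.punchInᵢ≢i i₀ (τ′ i) eq)
  τ-injective {Fin.suc i} {Fin.suc j} eq =
    cong Fin.suc (proj₁ (proj₂ rest) (FinP.punchIn-injective i₀ _ _ eq))

  τ-typed : ∀ j → Q (τ j) (F j) ≡ true
  τ-typed Fin.zero    = q₀
  τ-typed (Fin.suc j) = proj₂ (proj₂ rest) j

-- Finite enumerations: every x with P x is, up to ≈, decoded from some
-- code in Fin n.  They bound the number of configurations in the union bound.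
record Enumeration {X : Set} (_≈_ : X → X → Set) (P : X → Set) (n : ℕ) : Set where
  field
    decode   : Fin n → X
    complete : ∀ x → P x → ∃ λ c → decode c ≈ x
open Enumeration

everything : ∀ n → Enumeration _≡_ (λ (_ : Fin n) → ⊤) n
everything n = record { decode = id ; complete = λ x _ → x , refl }

_×ₑ_ : ∀ {X Y : Set} {_≈₁_ : X → X → Set} {_≈₂_ : Y → Y → Set} {P₁ : X → Set} {P₂ : Y → Set} {n₁ n₂} →
  Enumeration _≈₁_ P₁ n₁ → Enumeration _≈₂_ P₂ n₂ →
  Enumeration (Pointwise _≈₁_ _≈₂_) (λ p → P₁ (proj₁ p) × P₂ (proj₂ p)) (n₁ * n₂)
_×ₑ_ {_≈₁_ = _≈₁_} {_≈₂_} {n₁ = n₁} {n₂} e₁ e₂ = record { decode = dec ; complete = comp }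
  where
  dec : Fin (n₁ * n₂) → _
  dec c = decode e₁ (proj₁ (remQuot {n₁} n₂ c)) , decode e₂ (proj₂ (remQuot {n₁} n₂ c))
  comp : ∀ x → _ → ∃ λ c → Pointwise _≈₁_ _≈₂_ (dec c) x
  comp (x₁ , x₂) (p₁ , p₂) with complete e₁ x₁ p₁ | complete e₂ x₂ p₂
  ... | c₁ , d₁ | c₂ , d₂ =
    combine c₁ c₂ ,
    subst (λ q → Pointwise _≈₁_ _≈₂_ (decode e₁ (proj₁ q) , decode e₂ (proj₂ q)) (x₁ , x₂))
          (sym (FinP.remQuot-combine c₁ c₂)) (d₁ , d₂)

-- The falling factorial m(m-1)⋯(m-k+1), the number of injections Fin k → Fin m.
falling : ℕ → ℕ → ℕ
falling m zero = 1
falling zero (suc k) = 0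
falling (suc m) (suc k) = suc m * falling m k

-- A code for an injection is its first value together with (the code of)
-- the remaining values, which avoid the first and so live in Fin m.
decodeInjection : ∀ m k → Fin (falling m k) → Fin k → Fin m
decodeInjection (suc m) (suc k) c Fin.zero = proj₁ (remQuot {suc m} (falling m k) c)
decodeInjection (suc m) (suc k) c (Fin.suc t) =
  punchIn (proj₁ (remQuot {suc m} (falling m k) c))
          (decodeInjection m k (proj₂ (remQuot {suc m} (falling m k) c)) t)

injections : ∀ m k → Enumeration _≗_ (Injective _≡_ _≡_) (falling m k)
injections m k = record { decode = decodeInjection m k ; complete = encode m k }
  where
  encode : ∀ m k (σ : Fin k → Fin m) → Injective _≡_ _≡_ σ → ∃ λ c → decodeInjection m k c ≗ σ
  encode m zero σ _ = Fin.zero , λ ()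
  encode zero (suc k) σ _ with () ← σ Fin.zero
  encode (suc m) (suc k) σ σ-inj = combine (σ Fin.zero) (proj₁ rest) , decodes
    where
    avoidsFirst : ∀ t → σ Fin.zero ≢ σ (Fin.suc t)
    avoidsFirst t eq with () ← σ-inj eq
    σ′ : Fin k → Fin m
    σ′ t = punchOut (avoidsFirst t)
    σ′-inj : Injective _≡_ _≡_ σ′
    σ′-inj eq = FinP.suc-injective (σ-inj (FinP.punchOut-injective (avoidsFirst _) (avoidsFirst _) eq))
    rest = encode m k σ′ σ′-inj
    split : remQuot {suc m} (falling m k) (combine (σ Fin.zero) (proj₁ rest)) ≡ (σ Fin.zero , proj₁ rest)
    split = FinP.remQuot-combine (σ Fin.zero) (proj₁ rest)
    decodes : decodeInjection (suc m) (suc k) (combine (σ Fin.zero) (proj₁ rest)) ≗ σ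
    decodes Fin.zero = cong proj₁ split
    decodes (Fin.suc t) = begin
      decodeInjection (suc m) (suc k) (combine (σ Fin.zero) (proj₁ rest)) (Fin.suc t)
        ≡⟨ cong (λ (p : Fin (suc m) × Fin (falling m k)) → punchIn (proj₁ p) (decodeInjection m k (proj₂ p) t)) split ⟩
      punchIn (σ Fin.zero) (decodeInjection m k (proj₁ rest) t) ≡⟨ cong (punchIn (σ Fin.zero)) (proj₂ rest t) ⟩
      punchIn (σ Fin.zero) (σ′ t)                               ≡⟨ FinP.punchIn-punchOut (avoidsFirst t) ⟩
      σ (Fin.suc t)                                             ∎
      where open ≡-Reasoning

-- The number r(r-1)/2 of pairs a < b in Fin r.
pairCount : ℕ → ℕ
pairCount zero = 0
pairCount (suc r) = r + pairCount r

-- Pairs in Fin (suc r) either start at 0 (r of them) or are successors of pairs in Fin r.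
decodePair : ∀ r → Fin (pairCount r) → Fin r × Fin r
decodePair (suc r) c = [ (λ b → Fin.zero , Fin.suc b) , liftPair ∘ decodePair r ]′ (splitAt r c)
  where
  liftPair : Fin r × Fin r → Fin (suc r) × Fin (suc r)
  liftPair (a , b) = Fin.suc a , Fin.suc b

increasingPairs : ∀ r → Enumeration _≡_ (λ p → proj₁ p Fin.< proj₂ p) (pairCount r)
increasingPairs r = record { decode = decodePair r ; complete = λ { (a , b) → encode r a b } }
  where
  encode : ∀ r (a b : Fin r) → a Fin.< b → ∃ λ c → decodePair r c ≡ (a , b)
  encode (suc r) Fin.zero (Fin.suc b) _ =
    b ↑ˡ pairCount r , cong [ _ , _ ]′ (FinP.splitAt-↑ˡ r b (pairCount r))
  encode (suc r) (Fin.suc a) (Fin.suc b) (s≤s a<b) with encode r a b a<b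
  ... | c , e = r ↑ʳ c , trans (cong [ _ , _ ]′ (FinP.splitAt-↑ʳ r (pairCount r) c))
                              (cong (λ p → Fin.suc (proj₁ p) , Fin.suc (proj₂ p)) e)

pairCount≡C2 : ∀ r → pairCount r ≡ r C 2
pairCount≡C2 zero = refl
pairCount≡C2 (suc r) = trans (cong₂ _+_ (sym (nC1≡n r)) (pairCount≡C2 r)) (nCk+nC[k+1]≡[n+1]C[k+1] r 1)

absorption : ∀ m k → suc m * (m C k) ≡ suc k * (suc m C suc k)
absorption zero zero = refl
absorption zero (suc k) = begin
  1 * (0 C suc k)                   ≡⟨ cong (1 *_) (k>n⇒nCk≡0 {0} {suc k} (s≤s z≤n)) ⟩
  0                                 ≡⟨ sym (*-zeroʳ (suc (suc k))) ⟩
  suc (suc k) * 0                   ≡⟨ cong (suc (suc k) *_) (sym (k>n⇒nCk≡0 {1} {suc (suc k)} (s≤s (s≤s z≤n)))) ⟩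
  suc (suc k) * (1 C suc (suc k))   ∎
  where open ≡-Reasoning
absorption (suc m) zero = begin
  suc (suc m) * 1                   ≡⟨ *-identityʳ (suc (suc m)) ⟩
  suc (suc m)                       ≡⟨ sym (nC1≡n (suc (suc m))) ⟩
  suc (suc m) C 1                   ≡⟨ sym (+-identityʳ _) ⟩
  1 * (suc (suc m) C 1)             ∎
  where open ≡-Reasoning
absorption (suc m) (suc k) = begin
  suc (suc m) * X                              ≡⟨⟩
  X + suc m * X                                ≡⟨ cong (λ z → X + suc m * z) (sym (nCk+nC[k+1]≡[n+1]C[k+1] m k)) ⟩
  X + suc m * (m C k + m C suc k)              ≡⟨ cong (X +_) (*-distribˡ-+ (suc m) (m C k) (m C suc k)) ⟩
  X + (suc m * (m C k) + suc m * (m C suc k))  ≡⟨ cong₂ (λ u v → X + (u + v)) (absorption m k) (absorption m (suc k)) ⟩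
  X + (suc k * X + suc (suc k) * Y)            ≡⟨ sym (+-assoc X _ _) ⟩
  suc (suc k) * X + suc (suc k) * Y            ≡⟨ sym (*-distribˡ-+ (suc (suc k)) X Y) ⟩
  suc (suc k) * (X + Y)                        ≡⟨ cong (suc (suc k) *_) (nCk+nC[k+1]≡[n+1]C[k+1] (suc m) (suc k)) ⟩
  suc (suc k) * (suc (suc m) C suc (suc k))    ∎
  where
  open ≡-Reasoning
  X = suc m C suc k
  Y = suc m C suc (suc k)

falling≡C*! : ∀ m k → falling m k ≡ (m C k) * k !
falling≡C*! m zero = refl
falling≡C*! zero (suc k) = sym (cong (_* suc k !) (k>n⇒nCk≡0 {0} {suc k} (s≤s z≤n)))
falling≡C*! (suc m) (suc k) = begin
  suc m * falling m k             ≡⟨ cong (suc m *_) (falling≡C*! m k) ⟩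
  suc m * ((m C k) * k !)         ≡⟨ sym (*-assoc (suc m) (m C k) (k !)) ⟩
  suc m * (m C k) * k !           ≡⟨ cong (_* k !) (absorption m k) ⟩
  suc k * (suc m C suc k) * k !   ≡⟨ cong (_* k !) (*-comm (suc k) (suc m C suc k)) ⟩
  (suc m C suc k) * suc k * k !   ≡⟨ *-assoc (suc m C suc k) (suc k) (k !) ⟩
  (suc m C suc k) * (suc k * k !) ∎
  where open ≡-Reasoning

configuration-bound : ∀ m k r s c →
  falling m k * pairCount r * s * c ≡ (m C k) * (r C 2) * c * (k !) * s
configuration-bound m k r s c rewrite falling≡C*! m k | pairCount≡C2 r =
  solve 5 (λ x y z w v → x :* w :* y :* v :* z := x :* y :* z :* w :* v) refl
    (m C k) (r C 2) c (k !) s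
  where open +-*-Solver

-- Realisation.  relabel a b x is the 0/1 column x with 0 ↦ a and 1 ↦ b,
-- so column j of F(a,b) is relabel a b (F j); column i of A realises x on
-- the rows σ when it agrees there with relabel a b x.

relabel : ∀ {k r} → Fin r → Fin r → Col k Bool → Col k (Fin r)
relabel a b x t = if x t then b else a

relabel-injective : ∀ {k r} {a b : Fin r} → a ≢ b → ∀ {x y : Col k Bool} →
  relabel a b x ≗ relabel a b y → x ≗ y
relabel-injective {a = a} {b} a≢b {x} {y} e t with x t | y t | e t
... | true  | true  | _  = refl
... | false | false | _  = refl
... | true  | false | eq = ⊥-elim (a≢b (sym eq))
... | false | true  | eq = ⊥-elim (a≢b eq)

module _ {m n r : ℕ} (A : Mat m n (Fin r)) where

  realises : ∀ {k} → (Fin k → Fin m) → Fin r → Fin r → Fin n → Col k Bool → Bool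
  realises σ a b i x = ⌊ all? (λ t → A i (σ t) FinP.≟ relabel a b x t) ⌋

  realises-cong : ∀ {k} {σ σ′ : Fin k → Fin m} {a b} i {x y : Col k Bool} → σ ≗ σ′ → x ≗ y →
    realises σ a b i x ≡ realises σ′ a b i y
  realises-cong {σ = σ} {σ′} {a} {b} i {x} {y} eσ ex =
    ⌊⌋-cong (all? (λ t → A i (σ t) FinP.≟ relabel a b x t)) (all? (λ t → A i (σ′ t) FinP.≟ relabel a b y t))
      (λ h t → trans (cong (A i) (sym (eσ t))) (trans (h t) (cong (λ v → if v then b else a) (ex t))))
      (λ h t → trans (cong (A i) (eσ t)) (trans (h t) (cong (λ v → if v then b else a) (sym (ex t)))))

  realises-unique : ∀ {k} {σ : Fin k → Fin m} {a b} → a ≢ b → ∀ i {x y} →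
    realises σ a b i x ≡ true → realises σ a b i y ≡ true → x ≗ y
  realises-unique {σ = σ} {a} {b} a≢b i {x} {y} rx ry = relabel-injective a≢b λ t →
    trans (sym (⌊⌋-sound (all? (λ t → A i (σ t) FinP.≟ relabel a b x t)) rx t))
          (⌊⌋-sound (all? (λ t → A i (σ t) FinP.≟ relabel a b y t)) ry t)

  realised-configuration : ∀ {k l} (F : Mat k l Bool) {σ : Fin k → Fin m} {a b} →
    Injective _≡_ _≡_ σ → a ≢ b →
    (∀ j → mult (F j) F ≤ count (λ i → realises σ a b i (F j))) → subst01 F a b ≺ A
  realised-configuration F {σ} {a} {b} σ-inj a≢b enough
    with distinctRepresentatives F (realises σ a b) (λ i → realises-cong i (λ _ → refl))
           (realises-unique a≢b) enough
  ... | τ , τ-inj , τ-realises = σ , τ , σ-inj , τ-inj , λ t j →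
    ⌊⌋-sound (all? (λ t → A (τ j) (σ t) FinP.≟ relabel a b (F j) t)) (τ-realises j) t

module SupportReduction {m n r k l s : ℕ} (A : Mat m n (Fin r)) (F : Mat k l Bool)
  (S : Mat k s Bool) (inSupport : ∀ j′ → ∃ λ j → S j ≡ F j′) where

  μ : ℕ
  μ = maxMult F

  Configuration : Set
  Configuration = ((Fin k → Fin m) × (Fin r × Fin r)) × Fin s

  configurations : Enumeration (Pointwise (Pointwise _≗_ _≡_) _≡_)
    (λ c → (Injective _≡_ _≡_ (proj₁ (proj₁ c)) × proj₁ (proj₂ (proj₁ c)) Fin.< proj₂ (proj₂ (proj₁ c))) × ⊤)
    (falling m k * pairCount r * s)
  configurations = (injections m k ×ₑ increasingPairs r) ×ₑ everything s

  realisesConfiguration : Fin n → Configuration → Bool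
  realisesConfiguration i ((σ , (a , b)) , j) = realises A σ a b i (S j)

  realisesConfiguration-cong : ∀ i {c c′} → Pointwise (Pointwise _≗_ _≡_) _≡_ c c′ →
    realisesConfiguration i c ≡ realisesConfiguration i c′
  realisesConfiguration-cong i {(_ , _) , j} ((eσ , refl) , refl) = realises-cong A i {x = S j} eσ (λ _ → refl)

  open Pruning (λ i ℓ → realisesConfiguration i (decode configurations ℓ)) (μ ∸ 1) public

  reduced : Mat m (count kept) (Fin r)
  reduced = A ∘ select kept

  reduced-simple : Simple A → Simple reduced
  reduced-simple A-simple = select-injective kept ∘ A-simple

  -- A copy of S(a,b) in the reduced matrix on rows σ makes every column of
  -- S(a,b) frequent on σ, hence lifts to a copy of F(a,b) in A.
  reduced-avoids : AvoidsSym F A → AvoidsSym S reduced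
  reduced-avoids A-avoids a b a<b (σ , τ , σ-inj , τ-inj , copy) =
    A-avoids a b a<b (realised-configuration A F σ-inj (FinP.<⇒≢ a<b) enough)
    where
    code : Fin s → Fin (falling m k * pairCount r * s)
    code j = proj₁ (complete configurations ((σ , (a , b)) , j) ((σ-inj , a<b) , tt))

    decodes : ∀ j i → realisesConfiguration i (decode configurations (code j)) ≡ realises A σ a b i (S j)
    decodes j i = realisesConfiguration-cong i
      (proj₂ (complete configurations ((σ , (a , b)) , j) ((σ-inj , a<b) , tt)))

    frequent : ∀ j → μ ≤ count (λ i → realises A σ a b i (S j))
    frequent j = ≤-trans (m≤n+m∸n μ 1) (subst (μ ∸ 1 <_) (count-cong (decodes j))
      (kept-frequent (select kept (τ j)) (code j) (select-satisfies kept (τ j))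
        (trans (decodes j _) (⌊⌋-complete (all? _) (λ t → copy t j)))))

    enough : ∀ j′ → mult (F j′) F ≤ count (λ i → realises A σ a b i (F j′))
    enough j′ with inSupport j′
    ... | j , Sj≡Fj′ = subst (λ x → mult (F j′) F ≤ count (λ i → realises A σ a b i x)) Sj≡Fj′
                          (≤-trans (maxFin-≥ (λ j → mult (F j) F) j′) (frequent j))

mainTheorem2 : (r : ℕ) → 2 ≤ r → (k l : ℕ) → (F : Mat k l Bool) →
    (s : ℕ) → (S : Mat k s Bool) → IsSupp S F →
    (m N₁ N₂ : ℕ) → IsForbSym m r F N₁ → IsForbSym m r S N₂ →
    N₁ ≤ N₂ + (m C k) * (r C 2) * (maxMult F ∸ 1) * (k !) * s
mainTheorem2 r _ k l F s S (_ , _ , inSupport) m N₁ N₂ ((A , A-simple , A-avoids) , _) (_ , S-extremal) =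
  begin
    N₁                                ≤⟨ pruning-bound ⟩
    count kept + L * (μ ∸ 1)          ≤⟨ +-monoˡ-≤ (L * (μ ∸ 1)) reduced-small ⟩
    N₂ + L * (μ ∸ 1)                  ≡⟨ cong (N₂ +_) (configuration-bound m k r s (μ ∸ 1)) ⟩
    N₂ + (m C k) * (r C 2) * (μ ∸ 1) * (k !) * s ∎
  where
  open SupportReduction A F S inSupport
  open ≤-Reasoning
  L = falling m k * pairCount r * s
  reduced-small : count kept ≤ N₂
  reduced-small = S-extremal (count kept) reduced (reduced-simple A-simple) (reduced-avoids A-avoids)
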